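{- Let $\Gamma$ be an abelian group written additively and $\pi$ a $\Gamma$-quotient labeling of a finite graph $G$. Then $\mathcal L_\pi$ is a linear class of bonds of $G$, i.e., $(G,\mathcal L_\pi)$ is a cobiased graph.
   Context: A bond is a minimal nonempty edge cut; $\delta(X)$ is the set of non-loop edges with exactly one endpoint in a vertex set $X$. A tribond corresponds to a partition $\{X_1,X_2,X_3\}$ of the vertex set of one connected component into nonempty sets with each $G[X_i]$ connected and an edge joining each pair; its bonds are $\delta(X_1),\delta(X_2),\delta(X_3)$. A linear class of bonds is a set $\mathcal L$ of bonds such that for each such tripartition the number of $i$ with $\delta(X_i)\in\mathcal L$ is never exactly two. A $\Gamma$-quotient labeling is a map $\pi:V(G)\to\Gamma$ such that $\sum_{v\in V(H)}\pi(v)=0$ for each connected component $H$ of $G$; write $\pi(X)=\sum_{v\in X}\pi(v)$. For a bond $B=\delta(X)$ oriented towards $X$ (denoted $\vec B$), set $\pi(\vec B)=\pi(X)$; $B$ is cobalanced if $\pi(\vec B)=0$, and $\mathcal L_\pi$ is the set of cobalanced bonds. -}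

module Defs where

open import Level using (Level; _⊔_)
open import Data.Nat using (ℕ; zero; suc)
open import Data.Fin using (Fin; zero; suc)
open import Data.Bool using (Bool; true; false; if_then_else_; _xor_)
open import Data.Product using (Σ; ∃; _×_; _,_; proj₁; proj₂)
open import Data.Sum using (_⊎_)
open import Relation.Binary.PropositionalEquality using (_≡_; _≢_)
open import Relation.Nullary using (¬_)
open import Algebra.Bundles using (AbelianGroup)

record Graph : Set where
  field
    nV : ℕ
    nE : ℕ
    ends : Fin nE → Fin nV × Fin nV

module GraphNotions (G : Graph) where
  open Graph G

  Vertex : Set
  Vertex = Fin nV

  Edge : Set
  Edge = Fin nE

  VSet : Set
  VSet = Vertex → Bool

  ESet : Set
  ESet = Edge → Bool

  _∈V_ : Vertex → VSet → Set
  v ∈V X = X v ≡ true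

  _∈E_ : Edge → ESet → Set
  e ∈E B = B e ≡ true

  _≐_ : ESet → ESet → Set
  B ≐ C = ∀ e → B e ≡ C e

  _⊆E_ : ESet → ESet → Set
  B ⊆E C = ∀ e → e ∈E B → e ∈E C

  Joins : Edge → Vertex → Vertex → Set
  Joins e u w = (proj₁ (ends e) ≡ u × proj₂ (ends e) ≡ w)
              ⊎ (proj₁ (ends e) ≡ w × proj₂ (ends e) ≡ u)

  δ : VSet → ESet
  δ X e = X (proj₁ (ends e)) xor X (proj₂ (ends e))

  data PathIn (X : VSet) : Vertex → Vertex → Set where
    here : ∀ {u} → PathIn X u u
    step : ∀ {u w v} (e : Edge) → Joins e u w → w ∈V X → PathIn X w v → PathIn X u v

  NonemptyV : VSet → Set
  NonemptyV X = ∃ λ v → v ∈V X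

  ConnectedIn : VSet → Set
  ConnectedIn X = NonemptyV X × (∀ u v → u ∈V X → v ∈V X → PathIn X u v)

  IsComponent : VSet → Set
  IsComponent C = ConnectedIn C × (∀ e → ¬ (e ∈E δ C))

  IsEdgeCut : ESet → Set
  IsEdgeCut B = ∃ λ X → B ≐ δ X

  NonemptyE : ESet → Set
  NonemptyE B = ∃ λ e → e ∈E B

  IsBond : ESet → Set
  IsBond B = IsEdgeCut B × NonemptyE B
           × (∀ C → IsEdgeCut C → NonemptyE C → C ⊆E B → C ≐ B)

  record Tripartition (X₁ X₂ X₃ : VSet) : Set where
    field
      C : VSet
      component : IsComponent C
      cover : ∀ v → v ∈V C → (v ∈V X₁ ⊎ v ∈V X₂ ⊎ v ∈V X₃)
      sub₁ : ∀ v → v ∈V X₁ → v ∈V C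
      sub₂ : ∀ v → v ∈V X₂ → v ∈V C
      sub₃ : ∀ v → v ∈V X₃ → v ∈V C
      disj₁₂ : ∀ v → v ∈V X₁ → ¬ (v ∈V X₂)
      disj₁₃ : ∀ v → v ∈V X₁ → ¬ (v ∈V X₃)
      disj₂₃ : ∀ v → v ∈V X₂ → ¬ (v ∈V X₃)
      conn₁ : ConnectedIn X₁
      conn₂ : ConnectedIn X₂
      conn₃ : ConnectedIn X₃
      edge₁₂ : ∃ λ e → ∃ λ u → ∃ λ w → Joins e u w × u ∈V X₁ × w ∈V X₂
      edge₁₃ : ∃ λ e → ∃ λ u → ∃ λ w → Joins e u w × u ∈V X₁ × w ∈V X₃
      edge₂₃ : ∃ λ e → ∃ λ u → ∃ λ w → Joins e u w × u ∈V X₂ × w ∈V X₃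

  -- a linear class of bonds: a class of bonds such that for no tribond
  -- exactly two of δ(X₁), δ(X₂), δ(X₃) lie in the class.
  -- (Tripartitions are quantified in every order, so "exactly two" is
  -- expressed as: never the first two in and the third out.)
  IsLinearClass : ∀ {ℓ} → (ESet → Set ℓ) → Set ℓ
  IsLinearClass L =
    (∀ B → L B → IsBond B)
    × (∀ X₁ X₂ X₃ → Tripartition X₁ X₂ X₃ →
         ¬ (L (δ X₁) × L (δ X₂) × ¬ L (δ X₃)))

  module Labeling {c ℓ} (Γ : AbelianGroup c ℓ) where
    open AbelianGroup Γ renaming (Carrier to A)

    sumFin : ∀ {k} → (Fin k → A) → A
    sumFin {zero} f = ε
    sumFin {suc k} f = f zero ∙ sumFin (λ i → f (suc i))

    labelSum : (Vertex → A) → VSet → A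
    labelSum π X = sumFin (λ v → if X v then π v else ε)

    IsQuotientLabeling : (Vertex → A) → Set ℓ
    IsQuotientLabeling π = ∀ C → IsComponent C → labelSum π C ≈ ε

    Lπ : (Vertex → A) → ESet → Set ℓ
    Lπ π B = IsBond B × (∃ λ X → (B ≐ δ X) × (labelSum π X ≈ ε))

-- If δ X = δ Y with π(Y) = 0 and X lies in a component C, then X ⊕ Y has empty
-- coboundary, hence is a union of components: on C it is ∅ or C, so Y meets C in
-- X or in C ∖ X, and off C it agrees with X ⊕ Y, whose label sum is 0 because π
-- vanishes on components. As π(C) = 0 this gives π(X) = 0. For a tribond with δ X₁ and δ X₂ cobalanced
-- we get π(X₁) = π(X₂) = 0, hence π(X₃) = 0; and δ X₃ is a bond because G[X₃]
-- and G[X₁ ∪ X₂] are connected and joined by an edge.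
module Submission where

open import Defs
open import Algebra.Bundles using (AbelianGroup)
import Algebra.Properties.CommutativeMonoid.Sum as Sum
open import Data.Bool using (Bool; true; false; not; _∧_; _∨_; _xor_; if_then_else_)
open import Data.Bool.Properties
  using (_≟_; ¬-not; not-¬; not-injective; xor-same; xor-comm; xor-assoc; xor-identityʳ;
         xor-inverseˡ; xor-inverseʳ; ∧-zeroʳ; ∧-identityʳ; ∨-zeroʳ)
open import Data.Fin as Fin using (Fin)
open import Data.Fin.Properties using (any?) renaming (_≟_ to _≟ᶠ_)
import Data.Fin.Subset as Subset
open import Data.Fin.Subset.Properties using (∣p∣≤n; p⊂q⇒∣p∣<∣q∣)
open import Data.Nat using (ℕ; zero; suc; _≤_; _<_; z≤n)
open import Data.Nat.GeneralisedArithmetic using (fold)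
open import Data.Nat.Properties using (≤-refl; ≤-trans; ≤-pred; ≤-<-trans; <-≤-trans; n≮n)
open import Data.Product using (∃; _×_; _,_; proj₁; proj₂)
open import Data.Sum using (_⊎_; inj₁; inj₂)
open import Data.Vec using (tabulate)
open import Data.Vec.Properties using (lookup∘tabulate; lookup⇒[]=; []=⇒lookup)
open import Relation.Binary.PropositionalEquality
  using (_≡_; _≗_; refl; sym; trans; cong; cong₂; module ≡-Reasoning)
open import Relation.Nullary using (¬_; Dec; yes; no; does; contradiction; _×-dec_; _⊎-dec_)
open import Relation.Nullary.Decidable using (dec-true)

xor≡false⇒≡ : ∀ {a b} → a xor b ≡ false → a ≡ b
xor≡false⇒≡ {true}  {true}  _ = refl
xor≡false⇒≡ {false} {false} _ = refl

≡⇒xor≡false : ∀ {a b} → a ≡ b → a xor b ≡ false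
≡⇒xor≡false {a} refl = xor-same a

xor-cancelʳ : ∀ a b → (a xor b) xor b ≡ a
xor-cancelʳ a b = trans (xor-assoc a b b) (trans (cong (a xor_) (xor-same b)) (xor-identityʳ a))

xor-transpose : ∀ {a b c d} → a xor b ≡ c xor d → a xor c ≡ b xor d
xor-transpose {false} {_} {false} b≡d = sym (≡⇒xor≡false b≡d)
xor-transpose {true}  {_} {true}  ¬b≡¬d = sym (≡⇒xor≡false (not-injective ¬b≡¬d))
xor-transpose {true}  {b} {false} refl = sym (xor-inverseʳ b)
xor-transpose {false} {_} {true} {d} refl = sym (xor-inverseˡ d)

if-xor : ∀ a b x y → (if x then a else b) xor (if y then a else b) ≡ (a xor b) ∧ (x xor y)
if-xor a b true  true  = trans (xor-same a) (sym (∧-zeroʳ (a xor b)))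
if-xor a b true  false = sym (∧-identityʳ (a xor b))
if-xor a b false true  = trans (xor-comm b a) (sym (∧-identityʳ (a xor b)))
if-xor a b false false = trans (xor-same b) (sym (∧-zeroʳ (a xor b)))

∨-introˡ : ∀ {a b} → a ≡ true → a ∨ b ≡ true
∨-introˡ refl = refl

∨-introʳ : ∀ {a b} → b ≡ true → a ∨ b ≡ true
∨-introʳ {a} refl = ∨-zeroʳ a

∧-elimˡ : ∀ {a b} → a ∧ b ≡ true → a ≡ true
∧-elimˡ {true} _ = refl

∨-elim : ∀ {a b} → a ∨ b ≡ true → a ≡ true ⊎ b ≡ true
∨-elim {true}  _      = inj₁ refl
∨-elim {false} b≡true = inj₂ b≡true

module _ {n : ℕ} where

  infixr 6 _∪_ _∩_ _∖_ _⊕_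
  infix 4 _⊆_

  _⊆_ : (Fin n → Bool) → (Fin n → Bool) → Set
  X ⊆ Y = ∀ i → X i ≡ true → Y i ≡ true

  _∪_ _∩_ _∖_ _⊕_ : (Fin n → Bool) → (Fin n → Bool) → Fin n → Bool
  (X ∪ Y) i = X i ∨ Y i
  (X ∩ Y) i = X i ∧ Y i
  (X ∖ Y) i = X i ∧ not (Y i)
  (X ⊕ Y) i = X i xor Y i

  size : (Fin n → Bool) → ℕ
  size X = Subset.∣ tabulate X ∣

  size≤n : ∀ X → size X ≤ n
  size≤n X = ∣p∣≤n (tabulate X)

  private
    ∈-tabulate⁺ : ∀ (X : Fin n → Bool) {i} → X i ≡ true → i Subset.∈ tabulate X
    ∈-tabulate⁺ X {i} Xi = lookup⇒[]= i (tabulate X) (trans (lookup∘tabulate X i) Xi)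

    ∈-tabulate⁻ : ∀ (X : Fin n → Bool) {i} → i Subset.∈ tabulate X → X i ≡ true
    ∈-tabulate⁻ X {i} i∈ = trans (sym (lookup∘tabulate X i)) ([]=⇒lookup i∈)

  size-< : ∀ {X Y i} → X ⊆ Y → X i ≡ false → Y i ≡ true → size X < size Y
  size-< {X} {Y} {i} X⊆Y Xi Yi = p⊂q⇒∣p∣<∣q∣
    ( (λ i∈X → ∈-tabulate⁺ Y (X⊆Y _ (∈-tabulate⁻ X i∈X)))
    , i , ∈-tabulate⁺ Y Yi , λ i∈X → not-¬ (∈-tabulate⁻ X i∈X) Xi )

-- Kleene iteration of an inflationary monotone operator on subsets of Fin n
-- strictly grows until it stabilises, so n + 1 steps reach a fixed point.
module FiniteClosure {n : ℕ} (f : (Fin n → Bool) → Fin n → Bool)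
  (inflationary : ∀ X → X ⊆ f X) (monotone : ∀ {X Y} → X ⊆ Y → f X ⊆ f Y) where

  stage : (Fin n → Bool) → ℕ → Fin n → Bool
  stage X = fold X f

  stage-grows : ∀ X k → k ≤ size (stage X k) ⊎ f (stage X k) ⊆ stage X k
  stage-grows X zero    = inj₁ z≤n
  stage-grows X (suc k) =
    grows (stage-grows X k) (any? λ i → (f R i ≟ true) ×-dec (R i ≟ false))
    where
      R = stage X k
      grows : k ≤ size R ⊎ f R ⊆ R → Dec (∃ λ i → f R i ≡ true × R i ≡ false) →
              suc k ≤ size (f R) ⊎ f (f R) ⊆ f R
      grows _             (no ¬new)            = inj₂ (monotone λ i fRi → ¬-not λ Ri → ¬new (i , fRi , Ri))
      grows (inj₁ k≤)     (yes (i , fRi , Ri)) = inj₁ (≤-<-trans k≤ (size-< (inflationary R) Ri fRi))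
      grows (inj₂ stable) (yes (i , fRi , Ri)) = contradiction (stable i fRi) (not-¬ Ri)

  closure : (Fin n → Bool) → Fin n → Bool
  closure X = stage X (suc n)

  closure-closed : ∀ X → f (closure X) ⊆ closure X
  closure-closed X with stage-grows X (suc n)
  ... | inj₁ 1+n≤size = contradiction (≤-trans 1+n≤size (size≤n (closure X))) (n≮n n)
  ... | inj₂ stable   = stable

  closure-⊇ : ∀ X → X ⊆ closure X
  closure-⊇ X = stage-⊇ (suc n)
    where
      stage-⊇ : ∀ k → X ⊆ stage X k
      stage-⊇ zero    i Xi = Xi
      stage-⊇ (suc k) i Xi = inflationary (stage X k) i (stage-⊇ k i Xi)

  closure-ind : ∀ {ℓ} (P : Fin n → Set ℓ) {X} → (∀ i → X i ≡ true → P i) →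
                (∀ Y → (∀ i → Y i ≡ true → P i) → ∀ i → f Y i ≡ true → P i) →
                ∀ i → closure X i ≡ true → P i
  closure-ind P {X} base step = stage-ind (suc n)
    where
      stage-ind : ∀ k i → stage X k i ≡ true → P i
      stage-ind zero    = base
      stage-ind (suc k) = step (stage X k) (stage-ind k)

module Cuts (G : Graph) where
  open Graph G
  open GraphNotions G

  source target : Edge → Vertex
  source e = proj₁ (ends e)
  target e = proj₂ (ends e)

  δ-joins : ∀ X {e u w} → Joins e u w → δ X e ≡ X u xor X w
  δ-joins X (inj₁ (refl , refl)) = refl
  δ-joins X {e} (inj₂ (refl , refl)) = xor-comm (X (source e)) (X (target e))

  Joins-sym : ∀ {e u w} → Joins e u w → Joins e w u
  Joins-sym (inj₁ ends≡) = inj₂ ends≡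
  Joins-sym (inj₂ ends≡) = inj₁ ends≡

  snoc : ∀ {X u w x e} → PathIn X u w → Joins e w x → x ∈V X → PathIn X u x
  snoc here               j x∈X = step _ j x∈X here
  snoc (step e′ j′ w∈X p) j x∈X = step e′ j′ w∈X (snoc p j x∈X)

  reverse-++ : ∀ {X u w x} → u ∈V X → PathIn X u w → PathIn X u x → PathIn X w x
  reverse-++ u∈X here             q = q
  reverse-++ u∈X (step e j w∈X p) q = reverse-++ w∈X p (step e (Joins-sym j) u∈X q)

  Closed : VSet → Set
  Closed D = ∀ e → D (source e) ≡ D (target e)

  closed-joins : ∀ {D e u w} → Closed D → Joins e u w → D u ≡ D w
  closed-joins {e = e} closed (inj₁ (refl , refl)) = closed e
  closed-joins {e = e} closed (inj₂ (refl , refl)) = sym (closed e)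

  component⇒closed : ∀ {C} → IsComponent C → Closed C
  component⇒closed (_ , no-δ) e = xor≡false⇒≡ (¬-not (no-δ e))

  ∖-closed : ∀ {X Y} → Closed X → Closed Y → Closed (X ∖ Y)
  ∖-closed closedX closedY e = cong₂ (λ x y → x ∧ not y) (closedX e) (closedY e)

  restrict : ∀ {D X u w} → Closed D → u ∈V D → PathIn X u w → PathIn D u w
  restrict closed u∈D here           = here
  restrict closed u∈D (step e j _ p) = step e j w∈D (restrict closed w∈D p)
    where w∈D = trans (sym (closed-joins closed j)) u∈D

  UncutOn ConstantOn : VSet → VSet → Set
  UncutOn S W = ∀ {e u w} → Joins e u w → u ∈V S → w ∈V S → W u ≡ W w
  ConstantOn S W = ∀ {u w} → u ∈V S → w ∈V S → W u ≡ W w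

  CutConnected : VSet → Set
  CutConnected S = ∀ W → UncutOn S W → ConstantOn S W

  connected⇒cutConnected : ∀ {S} → ConnectedIn S → CutConnected S
  connected⇒cutConnected {S} (_ , paths) W uncut u∈S w∈S = along (paths _ _ u∈S w∈S) u∈S
    where
      along : ∀ {u w} → PathIn S u w → u ∈V S → W u ≡ W w
      along here              _   = refl
      along (step e j x∈S p) u∈S = trans (uncut j u∈S x∈S) (along p x∈S)

  Bridge : VSet → VSet → Set
  Bridge A B = ∃ λ e → ∃ λ u → ∃ λ w → Joins e u w × u ∈V A × w ∈V B

  cutConnected-∪ : ∀ {A B} → CutConnected A → CutConnected B → Bridge A B → CutConnected (A ∪ B)
  cutConnected-∪ {A} {B} cutA cutB (_ , a , b , j , a∈A , b∈B) W uncut u∈ w∈ =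
    join (∨-elim u∈) (∨-elim w∈)
    where
      onA : ConstantOn A W
      onA = cutA W λ j u∈A w∈A → uncut j (∨-introˡ u∈A) (∨-introˡ w∈A)
      onB : ConstantOn B W
      onB = cutB W λ j u∈B w∈B → uncut j (∨-introʳ u∈B) (∨-introʳ w∈B)
      a~b : W a ≡ W b
      a~b = uncut j (∨-introˡ a∈A) (∨-introʳ b∈B)
      join : ∀ {u w} → u ∈V A ⊎ u ∈V B → w ∈V A ⊎ w ∈V B → W u ≡ W w
      join (inj₁ u∈A) (inj₁ w∈A) = onA u∈A w∈A
      join (inj₁ u∈A) (inj₂ w∈B) = trans (onA u∈A a∈A) (trans a~b (onB b∈B w∈B))
      join (inj₂ u∈B) (inj₁ w∈A) = trans (onB u∈B b∈B) (trans (sym a~b) (onA a∈A w∈A))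
      join (inj₂ u∈B) (inj₂ w∈B) = onB u∈B w∈B

  closed⇒constantOn : ∀ {D S} → Closed D → CutConnected S → ConstantOn S D
  closed⇒constantOn {D} closed cut = cut D λ j _ _ → closed-joins closed j

  δ⊆⇒uncut : ∀ {S P W} → δ W ⊆E δ P → ConstantOn S P → UncutOn S W
  δ⊆⇒uncut {P = P} {W} δW⊆δP constP {e} j u∈S w∈S =
    xor≡false⇒≡ (trans (sym (δ-joins W j)) δWe≡false)
    where
      δPe≡false = trans (δ-joins P j) (≡⇒xor≡false (constP u∈S w∈S))
      δWe≡false = ¬-not λ δWe → not-¬ (δW⊆δP e δWe) δPe≡false

  Neighbour : VSet → Vertex → Set
  Neighbour R u = ∃ λ e → ∃ λ x → x ∈V R × Joins e x u

  neighbour? : ∀ R u → Dec (Neighbour R u)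
  neighbour? R u = any? λ e → any? λ x → (R x ≟ true) ×-dec joins? e x u
    where
      joins? : ∀ e x u → Dec (Joins e x u)
      joins? e x u = ((source e ≟ᶠ x) ×-dec (target e ≟ᶠ u)) ⊎-dec ((source e ≟ᶠ u) ×-dec (target e ≟ᶠ x))

  grow : VSet → VSet
  grow R u = R u ∨ does (neighbour? R u)

  grow-elim : ∀ {R u} → u ∈V grow R → u ∈V R ⊎ Neighbour R u
  grow-elim {R} {u} u∈ with R u | neighbour? R u
  ... | true  | _       = inj₁ refl
  ... | false | yes nbr = inj₂ nbr

  grow-neighbour : ∀ {R e x u} → x ∈V R → Joins e x u → u ∈V grow R
  grow-neighbour {R} {e} {x} {u} x∈R j = ∨-introʳ {R u} (dec-true (neighbour? R u) (e , x , x∈R , j))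

  grow-inflationary : ∀ R → R ⊆ grow R
  grow-inflationary R u u∈R = ∨-introˡ u∈R

  grow-monotone : ∀ {R S} → R ⊆ S → grow R ⊆ grow S
  grow-monotone R⊆S u u∈ with grow-elim u∈
  ... | inj₁ u∈R               = grow-inflationary _ u (R⊆S u u∈R)
  ... | inj₂ (_ , x , x∈R , j) = grow-neighbour (R⊆S x x∈R) j

  grow-stable⇒closed : ∀ {R} → grow R ⊆ R → Closed R
  grow-stable⇒closed {R} stable e with R (source e) in s∈ | R (target e) in t∈
  ... | true  | true  = refl
  ... | false | false = refl
  ... | true  | false = contradiction (stable _ (grow-neighbour s∈ (inj₁ (refl , refl)))) (not-¬ t∈)
  ... | false | true  = contradiction (stable _ (grow-neighbour t∈ (inj₂ (refl , refl)))) (not-¬ s∈)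

  open FiniteClosure grow grow-inflationary grow-monotone

  ⁅_⁆ : Vertex → VSet
  ⁅ v ⁆ u = does (v ≟ᶠ u)

  componentOf : Vertex → VSet
  componentOf v = closure ⁅ v ⁆

  ∈-componentOf : ∀ v → v ∈V componentOf v
  ∈-componentOf v = closure-⊇ ⁅ v ⁆ v (dec-true (v ≟ᶠ v) refl)

  componentOf-closed : ∀ v → Closed (componentOf v)
  componentOf-closed v = grow-stable⇒closed (closure-closed ⁅ v ⁆)

  componentOf-least : ∀ {D v} → Closed D → v ∈V D → componentOf v ⊆ D
  componentOf-least {D} {v} closed v∈D = closure-ind (λ u → u ∈V D) singleton neighbours
    where
      singleton : ∀ u → u ∈V ⁅ v ⁆ → u ∈V D
      singleton u u∈ with v ≟ᶠ u
      ... | yes refl = v∈D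
      neighbours : ∀ Y → Y ⊆ D → grow Y ⊆ D
      neighbours Y Y⊆D u u∈ with grow-elim u∈
      ... | inj₁ u∈Y               = Y⊆D u u∈Y
      ... | inj₂ (_ , x , x∈Y , j) = trans (sym (closed-joins closed j)) (Y⊆D x x∈Y)

  -- Walks in the whole graph; they stay inside a component since it is closed.
  walk-from : ∀ v u → u ∈V componentOf v → PathIn (λ _ → true) v u
  walk-from v = closure-ind (PathIn (λ _ → true) v) singleton neighbours
    where
      singleton : ∀ u → u ∈V ⁅ v ⁆ → PathIn (λ _ → true) v u
      singleton u u∈ with v ≟ᶠ u
      ... | yes refl = here
      neighbours : ∀ Y → (∀ u → u ∈V Y → PathIn (λ _ → true) v u) →
                   ∀ u → u ∈V grow Y → PathIn (λ _ → true) v u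
      neighbours Y walks u u∈ with grow-elim u∈
      ... | inj₁ u∈Y               = walks u u∈Y
      ... | inj₂ (_ , x , x∈Y , j) = snoc (walks x x∈Y) j refl

  componentOf-isComponent : ∀ v → IsComponent (componentOf v)
  componentOf-isComponent v =
    ((v , ∈-componentOf v) , λ u w u∈ w∈ → reverse-++ (∈-componentOf v) (path u u∈) (path w w∈)) ,
    λ e → not-¬ (≡⇒xor≡false (componentOf-closed v e))
    where
      path : ∀ u → u ∈V componentOf v → PathIn (componentOf v) v u
      path u u∈ = restrict (componentOf-closed v) (∈-componentOf v) (walk-from v u u∈)

  record Split (C P Q : VSet) : Set where
    field
      isComponent   : IsComponent C
      partition     : ∀ v → C v ≡ P v ∨ Q v
      disjoint      : ∀ v → P v ≡ true → Q v ≡ false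
      cutConnectedP : CutConnected P
      cutConnectedQ : CutConnected Q
      bridge        : Bridge P Q

  module _ {C P Q : VSet} (split : Split C P Q) where
    open Split split

    Q⇒¬P : ∀ {v} → v ∈V Q → P v ≡ false
    Q⇒¬P {v} v∈Q = ¬-not λ v∈P → not-¬ v∈Q (disjoint v v∈P)

    outside⇒¬P : ∀ {v} → C v ≡ false → P v ≡ false
    outside⇒¬P {v} v∉C = ¬-not λ v∈P → not-¬ (trans (partition v) (∨-introˡ v∈P)) v∉C

    -- W is constant on each block, so δ W is δ P or empty.
    δ-within-split : ∀ {W p q} → δ W ⊆E δ P → p ∈V P → q ∈V Q →
                     ∀ e → δ W e ≡ (W p xor W q) ∧ δ P e
    δ-within-split {W} {p} {q} δW⊆δP p∈P q∈Q e with C (source e) in s∈C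
    ... | true  = begin
      W (source e) xor W (target e)
        ≡⟨ cong₂ _xor_ (determined s∈C) (determined t∈C) ⟩
      (if P (source e) then W p else W q) xor (if P (target e) then W p else W q)
        ≡⟨ if-xor (W p) (W q) (P (source e)) (P (target e)) ⟩
      (W p xor W q) ∧ δ P e ∎
      where
        open ≡-Reasoning
        t∈C = trans (sym (component⇒closed isComponent e)) s∈C
        determined : ∀ {x} → x ∈V C → W x ≡ (if P x then W p else W q)
        determined {x} x∈C with P x in x∈P
        ... | true  = cutConnectedP W (δ⊆⇒uncut δW⊆δP λ u∈ w∈ → trans u∈ (sym w∈)) x∈P p∈P
        ... | false = cutConnectedQ W (δ⊆⇒uncut δW⊆δP λ u∈ w∈ → trans (Q⇒¬P u∈) (sym (Q⇒¬P w∈)))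
                        (trans (sym (trans (partition x) (cong (_∨ Q x) x∈P))) x∈C) q∈Q
    ... | false = trans δWe≡false (sym (trans (cong ((W p xor W q) ∧_) δPe≡false) (∧-zeroʳ _)))
      where
        t∉C = trans (sym (component⇒closed isComponent e)) s∈C
        δPe≡false = cong₂ _xor_ (outside⇒¬P s∈C) (outside⇒¬P t∉C)
        δWe≡false = ¬-not λ δWe → not-¬ (δW⊆δP e δWe) δPe≡false

    split⇒bond : IsBond (δ P)
    split⇒bond with bridge
    ... | e₀ , p , q , j , p∈P , q∈Q = (P , λ _ → refl) , (e₀ , δPe₀) , minimal
      where
        δPe₀ : e₀ ∈E δ P
        δPe₀ = trans (δ-joins P j) (cong₂ _xor_ p∈P (Q⇒¬P q∈Q))
        minimal : ∀ B → IsEdgeCut B → NonemptyE B → B ⊆E δ P → B ≐ δ P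
        minimal B (W , B≐δW) (e , e∈B) B⊆δP
          with W p xor W q | δ-within-split {W} (λ e δWe → B⊆δP e (trans (B≐δW e) δWe)) p∈P q∈Q
        ... | true  | δW≐δP = λ e → trans (B≐δW e) (δW≐δP e)
        ... | false | δW≐∅  = contradiction (trans (sym (B≐δW e)) e∈B) (not-¬ (δW≐∅ e))

  tripartition⇒split : ∀ {X₁ X₂ X₃} (T : Tripartition X₁ X₂ X₃) →
                       Split (Tripartition.C T) X₃ (X₁ ∪ X₂)
  tripartition⇒split {X₁} {X₂} {X₃} T = record
    { isComponent   = component
    ; partition     = partition
    ; disjoint      = λ v v∈X₃ → cong₂ _∨_ (¬-not λ v∈X₁ → disj₁₃ v v∈X₁ v∈X₃)
                                            (¬-not λ v∈X₂ → disj₂₃ v v∈X₂ v∈X₃)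
    ; cutConnectedP = connected⇒cutConnected conn₃
    ; cutConnectedQ = cutConnected-∪ (connected⇒cutConnected conn₁) (connected⇒cutConnected conn₂) edge₁₂
    ; bridge        = bridge₃
    }
    where
      open Tripartition T
      partition : ∀ v → C v ≡ X₃ v ∨ (X₁ v ∨ X₂ v)
      partition v with C v in v∈C
      ... | false = sym (cong₂ _∨_ (outside X₃ (sub₃ v)) (cong₂ _∨_ (outside X₁ (sub₁ v)) (outside X₂ (sub₂ v))))
        where
          outside : ∀ X → (v ∈V X → v ∈V C) → X v ≡ false
          outside X sub = ¬-not λ v∈X → not-¬ (sub v∈X) v∈C
      ... | true with cover v v∈C
      ...   | inj₁ v∈X₁        = sym (∨-introʳ {X₃ v} (∨-introˡ v∈X₁))
      ...   | inj₂ (inj₁ v∈X₂) = sym (∨-introʳ {X₃ v} (∨-introʳ {X₁ v} v∈X₂))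
      ...   | inj₂ (inj₂ v∈X₃) = sym (∨-introˡ v∈X₃)
      bridge₃ : Bridge X₃ (X₁ ∪ X₂)
      bridge₃ with edge₁₃
      ... | e , u , w , j , u∈X₁ , w∈X₃ = e , w , u , Joins-sym j , w∈X₃ , ∨-introˡ u∈X₁

module LabelSums (G : Graph) {c ℓ} (Γ : AbelianGroup c ℓ)
  (π : GraphNotions.Vertex G → AbelianGroup.Carrier Γ) where
  open Graph G
  open GraphNotions G
  open Labeling Γ
  open AbelianGroup Γ renaming (refl to ≈-refl; sym to ≈-sym; trans to ≈-trans)
  open Sum commutativeMonoid using (sum; sum-cong-≋; ∑-distrib-+; sum-replicate-zero)
  open Cuts G
  open import Relation.Binary.Reasoning.Setoid setoid

  x∙y≈ε⇒x≈ε : ∀ {x y} → y ≈ ε → x ∙ y ≈ ε → x ≈ ε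
  x∙y≈ε⇒x≈ε {x} {y} y≈ε x∙y≈ε = begin
    x     ≈⟨ identityʳ x ⟨
    x ∙ ε ≈⟨ ∙-congˡ y≈ε ⟨
    x ∙ y ≈⟨ x∙y≈ε ⟩
    ε     ∎

  indicator : VSet → Vertex → Carrier
  indicator X v = if X v then π v else ε

  labelSum≡sum : ∀ X → labelSum π X ≡ sum (indicator X)
  labelSum≡sum X = sumFin≡sum (indicator X)
    where
      sumFin≡sum : ∀ {k} (f : Fin k → Carrier) → sumFin f ≡ sum f
      sumFin≡sum {zero}  f = refl
      sumFin≡sum {suc k} f = cong (f Fin.zero ∙_) (sumFin≡sum (λ i → f (Fin.suc i)))

  labelSum-cong : ∀ {X Y} → X ≗ Y → labelSum π X ≈ labelSum π Y
  labelSum-cong {X} {Y} X≗Y = begin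
    labelSum π X      ≡⟨ labelSum≡sum X ⟩
    sum (indicator X) ≈⟨ sum-cong-≋ (λ v → reflexive (cong (λ b → if b then π v else ε) (X≗Y v))) ⟩
    sum (indicator Y) ≡⟨ labelSum≡sum Y ⟨
    labelSum π Y      ∎

  labelSum-∅ : ∀ {X} → (∀ v → X v ≡ false) → labelSum π X ≈ ε
  labelSum-∅ {X} X≗∅ = begin
    labelSum π X                  ≈⟨ labelSum-cong {Y = λ _ → false} X≗∅ ⟩
    labelSum π (λ _ → false)      ≡⟨ labelSum≡sum (λ _ → false) ⟩
    sum (indicator (λ _ → false)) ≈⟨ sum-replicate-zero nV ⟩
    ε                             ∎

  labelSum-partition : ∀ {C P Q} → (∀ v → C v ≡ P v ∨ Q v) → (∀ v → P v ≡ true → Q v ≡ false) →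
                       labelSum π C ≈ labelSum π P ∙ labelSum π Q
  labelSum-partition {C} {P} {Q} partition disjoint = begin
    labelSum π C                              ≡⟨ labelSum≡sum C ⟩
    sum (indicator C)                         ≈⟨ sum-cong-≋ pointwise ⟩
    sum (λ v → indicator P v ∙ indicator Q v) ≈⟨ ∑-distrib-+ (indicator P) (indicator Q) ⟩
    sum (indicator P) ∙ sum (indicator Q)     ≡⟨ cong₂ _∙_ (labelSum≡sum P) (labelSum≡sum Q) ⟨
    labelSum π P ∙ labelSum π Q               ∎
    where
      indicator-∨ : ∀ p q x → (p ≡ true → q ≡ false) →
                    (if p ∨ q then x else ε) ≈ (if p then x else ε) ∙ (if q then x else ε)
      indicator-∨ true  q     x disj rewrite disj refl = ≈-sym (identityʳ x)
      indicator-∨ false true  x _    = ≈-sym (identityˡ x)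
      indicator-∨ false false x _    = ≈-sym (identityˡ ε)
      pointwise : ∀ v → indicator C v ≈ indicator P v ∙ indicator Q v
      pointwise v = ≈-trans (reflexive (cong (λ b → if b then π v else ε) (partition v)))
                            (indicator-∨ (P v) (Q v) (π v) (disjoint v))

  labelSum-split : ∀ X Y → labelSum π X ≈ labelSum π (X ∩ Y) ∙ labelSum π (X ∖ Y)
  labelSum-split X Y = labelSum-partition partition disjoint
    where
      partition : ∀ v → X v ≡ (X ∩ Y) v ∨ (X ∖ Y) v
      partition v with X v | Y v
      ... | true  | true  = refl
      ... | true  | false = refl
      ... | false | _     = refl
      disjoint : ∀ v → (X ∩ Y) v ≡ true → (X ∖ Y) v ≡ false
      disjoint v with X v | Y v
      ... | true  | true  = λ _ → refl
      ... | false | _     = λ _ → refl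

  module _ (quotient : IsQuotientLabeling π) where

    -- A closed set is a union of components; peel them off one at a time.
    closed⇒balanced : ∀ {D} → Closed D → labelSum π D ≈ ε
    closed⇒balanced {D} = peel (suc (size D)) ≤-refl
      where
        peel : ∀ k {D} → size D < k → Closed D → labelSum π D ≈ ε
        peel (suc k) {D} size<1+k closedD with any? (λ v → D v ≟ true)
        ... | no empty      = labelSum-∅ λ v → ¬-not λ v∈D → empty (v , v∈D)
        ... | yes (v , v∈D) = begin
          labelSum π D                            ≈⟨ labelSum-split D K ⟩
          labelSum π (D ∩ K) ∙ labelSum π (D ∖ K) ≈⟨ ∙-cong (labelSum-cong D∩K≗K) rest ⟩
          labelSum π K ∙ ε                        ≈⟨ identityʳ _ ⟩
          labelSum π K                            ≈⟨ quotient K (componentOf-isComponent v) ⟩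
          ε                                       ∎
          where
            K = componentOf v
            D∩K≗K : D ∩ K ≗ K
            D∩K≗K u with K u in u∈K
            ... | true  = trans (∧-identityʳ (D u)) (componentOf-least closedD v∈D u u∈K)
            ... | false = ∧-zeroʳ (D u)
            v∉D∖K : (D ∖ K) v ≡ false
            v∉D∖K = trans (cong (λ b → D v ∧ not b) (∈-componentOf v)) (∧-zeroʳ (D v))
            smaller : size (D ∖ K) < size D
            smaller = size-< {X = D ∖ K} {Y = D} (λ _ → ∧-elimˡ) v∉D∖K v∈D
            rest : labelSum π (D ∖ K) ≈ ε
            rest = peel k (<-≤-trans smaller (≤-pred size<1+k))
                          (∖-closed {D} {K} closedD (componentOf-closed v))

    cobalanced-within-component : ∀ {C P Y} → IsComponent C → P ⊆ C → δ P ≗ δ Y →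
                                  labelSum π Y ≈ ε → labelSum π P ≈ ε
    cobalanced-within-component {C} {P} {Y} isComponent P⊆C δP≗δY πY≈ε = by-side (Z c₀) Y∩C≗
      where
        Z = Y ⊕ P
        c₀ = proj₁ (proj₁ (proj₁ isComponent))
        c₀∈C = proj₂ (proj₁ (proj₁ isComponent))
        closedZ : Closed Z
        closedZ e =
          xor-transpose {Y (source e)} {Y (target e)} {P (source e)} {P (target e)} (sym (δP≗δY e))
        Z-constant : ∀ {v} → v ∈V C → Z v ≡ Z c₀
        Z-constant v∈C =
          closed⇒constantOn closedZ (connected⇒cutConnected (proj₁ isComponent)) v∈C c₀∈C
        P-outside : ∀ {v} → C v ≡ false → P v ≡ false
        P-outside {v} v∉C = ¬-not λ v∈P → not-¬ (P⊆C v v∈P) v∉C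
        Y∖C≗Z∖C : Y ∖ C ≗ Z ∖ C
        Y∖C≗Z∖C v with C v in v∈C
        ... | true  = trans (∧-zeroʳ (Y v)) (sym (∧-zeroʳ (Z v)))
        ... | false =
          cong (_∧ true) (sym (trans (cong (Y v xor_) (P-outside v∈C)) (xor-identityʳ (Y v))))
        πY∖C : labelSum π (Y ∖ C) ≈ ε
        πY∖C = ≈-trans (labelSum-cong Y∖C≗Z∖C)
                       (closed⇒balanced (∖-closed {Z} {C} closedZ (component⇒closed isComponent)))
        πY∩C : labelSum π (Y ∩ C) ≈ ε
        πY∩C = x∙y≈ε⇒x≈ε πY∖C (≈-trans (≈-sym (labelSum-split Y C)) πY≈ε)
        Y∩C≗ : ∀ v → (Y ∩ C) v ≡ C v ∧ (Z c₀ xor P v)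
        Y∩C≗ v with C v in v∈C
        ... | true  = trans (∧-identityʳ (Y v))
                            (trans (sym (xor-cancelʳ (Y v) (P v))) (cong (_xor P v) (Z-constant v∈C)))
        ... | false = ∧-zeroʳ (Y v)
        C∩P≗P : C ∩ P ≗ P
        C∩P≗P v with P v in v∈P
        ... | true  = trans (∧-identityʳ (C v)) (P⊆C v v∈P)
        ... | false = ∧-zeroʳ (C v)
        by-side : ∀ z → (∀ v → (Y ∩ C) v ≡ C v ∧ (z xor P v)) → labelSum π P ≈ ε
        by-side false Y∩C≗C∩P = ≈-trans (labelSum-cong λ v → sym (trans (Y∩C≗C∩P v) (C∩P≗P v))) πY∩C
        by-side true  Y∩C≗C∖P = ≈-trans (≈-sym (labelSum-cong C∩P≗P))
          (x∙y≈ε⇒x≈ε (≈-trans (≈-sym (labelSum-cong Y∩C≗C∖P)) πY∩C)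
                     (≈-trans (≈-sym (labelSum-split C P)) (quotient C isComponent)))

proposition4p5 : ∀ {c ℓ} (Γ : AbelianGroup c ℓ) (G : Graph)
    (π : GraphNotions.Vertex G → AbelianGroup.Carrier Γ)
    → GraphNotions.Labeling.IsQuotientLabeling G Γ π
    → GraphNotions.IsLinearClass G (GraphNotions.Labeling.Lπ G Γ π)
proposition4p5 Γ G π quotient = (λ _ → proj₁) , never-exactly-two
  where
    open GraphNotions G
    open Labeling Γ
    open AbelianGroup Γ using (_≈_; _∙_; ε; ∙-cong; identityˡ) renaming (trans to ≈-trans; sym to ≈-sym)
    open Cuts G
    open LabelSums G Γ π

    never-exactly-two : ∀ X₁ X₂ X₃ → Tripartition X₁ X₂ X₃ →
                        ¬ (Lπ π (δ X₁) × Lπ π (δ X₂) × ¬ Lπ π (δ X₃))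
    never-exactly-two X₁ X₂ X₃ T ((_ , Y₁ , δX₁≗δY₁ , πY₁≈ε) , (_ , Y₂ , δX₂≗δY₂ , πY₂≈ε) , ∉Lπ) =
      ∉Lπ (split⇒bond split , X₃ , (λ _ → refl) , πX₃≈ε)
      where
        open Tripartition T
        split = tripartition⇒split T
        πX₁≈ε = cobalanced-within-component quotient component sub₁ δX₁≗δY₁ πY₁≈ε
        πX₂≈ε = cobalanced-within-component quotient component sub₂ δX₂≗δY₂ πY₂≈ε
        πX₁∪X₂≈ε : labelSum π (X₁ ∪ X₂) ≈ ε
        πX₁∪X₂≈ε = ≈-trans (labelSum-partition (λ _ → refl) (λ v v∈X₁ → ¬-not (disj₁₂ v v∈X₁)))
                           (≈-trans (∙-cong πX₁≈ε πX₂≈ε) (identityˡ ε))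
        πX₃≈ε : labelSum π X₃ ≈ ε
        πX₃≈ε = x∙y≈ε⇒x≈ε πX₁∪X₂≈ε
          (≈-trans (≈-sym (labelSum-partition (Split.partition split) (Split.disjoint split)))
                   (quotient C component))
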